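{- Let $V_1,\ldots,V_n$ be pairwise disjoint finite sets with $|V_i|\ge 2$ for all $i$. The number of edge sets $E$ such that $(V_1,\ldots,V_n,E)$ is an octahedral system equals $2^{\prod_{i=1}^n|V_i|-\prod_{i=1}^n(|V_i|-1)}$.
   Context: An $n$-uniform hypergraph is $n$-partite if its vertex set is the disjoint union of $n$ sets $V_1,\ldots,V_n$ and each edge meets each $V_i$ in exactly one vertex; it is written $(V_1,\ldots,V_n,E)$. An octahedral system is such a hypergraph with $|V_i|\ge 2$ for all $i$ satisfying the parity condition: for every $X\subseteq\bigcup_i V_i$ with $|X\cap V_i|=2$ for all $i$, the number of edges contained in $X$ is even. Octahedral systems differing by their edge sets are counted as distinct (no identification up to isomorphism). -}

module Defs where

open import Data.Nat using (ℕ; zero; suc; _+_; _*_; _∸_; _%_)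
open import Data.Fin using (Fin)
open import Data.List using (List; []; _∷_; map; _++_; filter; length; foldr)
open import Data.Product using (Σ; _×_; _,_)
open import Data.Unit using (⊤; tt)
open import Data.Bool using (Bool; true; false; T)
open import Relation.Nullary using (¬_)
open import Relation.Binary.PropositionalEquality using (_≡_)
open import Data.Bool.Properties using (T?)

-- A partition class V_i is modelled as Fin (|V_i|); the sizes of the n
-- classes are given by a list ms = (|V_1|, ..., |V_n|).  Different classes
-- are disjoint by construction (vertices are tagged by their class index).

-- A potential edge of an n-partite n-uniform hypergraph: one vertex of
-- each class, i.e. an element of V_1 × ... × V_n.
Tuple : List ℕ → Set
Tuple []       = ⊤
Tuple (k ∷ ks) = Fin k × Tuple ks

EdgeSet : List ℕ → Set
EdgeSet ms = Tuple ms → Bool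

-- A set X with |X ∩ V_i| = 2 for every i: two distinct vertices per class.
Box : List ℕ → Set
Box []       = ⊤
Box (k ∷ ks) = (Σ (Fin k) λ a → Σ (Fin k) λ b → ¬ a ≡ b) × Box ks

boxTuples : (ms : List ℕ) → Box ms → List (Tuple ms)
boxTuples []       tt                   = tt ∷ []
boxTuples (k ∷ ks) ((a , b , _) , rest) =
  map (a ,_) (boxTuples ks rest) ++ map (b ,_) (boxTuples ks rest)

edgesIn : (ms : List ℕ) → EdgeSet ms → Box ms → ℕ
edgesIn ms E X = length (filter (λ t → T? (E t)) (boxTuples ms X))

IsOctahedral : (ms : List ℕ) → EdgeSet ms → Set
IsOctahedral ms E = (X : Box ms) → edgesIn ms E X % 2 ≡ 0

prod : List ℕ → ℕ
prod = foldr _*_ 1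

prodPred : List ℕ → ℕ
prodPred ms = prod (map (λ k → k ∸ 1) ms)

module Submission where

-- Work over 𝔽₂ = (Bool, xor).  An edge set E is octahedral iff its xor over
-- the 2^n edges of every box X (two vertices per class) vanishes: E is
-- 'Balanced'.  Split off the first class Fin (suc k) and write E_a for the
-- slice of E at vertex a, an edge set on the remaining classes.  The box over
-- a ≠ b and X has xor  (xor of E_a over X) xor (xor of E_b over X),  so E is
-- balanced iff every difference E_(a+1) xor E_0 (a : Fin k) is balanced on the
-- remaining classes.  The shear E ↦ (E_0 , (E_(a+1) xor E_0)_a) is invertible,
-- so octahedral systems correspond to an arbitrary E_0 together with k
-- octahedral systems on the remaining classes.  With N = ∏|V_i| and
-- P = ∏(|V_i| − 1) over those classes, induction gives the count
-- 2^N · (2^(N − P))^k = 2^((k+1)N − kP).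
--
-- The formula holds for all class sizes.

open import Defs
open import Data.Nat using (ℕ; _≤_; _^_; _∸_)
open import Data.Fin using (Fin)
open import Data.List using (List)
open import Data.List.Relation.Unary.All using (All)
open import Data.Product using (Σ; _×_)
open import Data.Bool using (Bool)
open import Relation.Binary.PropositionalEquality using (_≡_)

open import Data.Nat using (suc; zero; _+_; _*_; _%_; s≤s; z≤n)
open import Data.Nat.Properties
  using (*-comm; *-mono-≤; *-monoʳ-≤; m∸n≤m; ^-*-assoc; ^-distribˡ-+-*; *-distribˡ-∸; +-∸-assoc)
open import Data.Nat.DivMod using (%-distribˡ-+)
open import Data.Fin using (zero; suc; combine; remQuot)
open import Data.Fin.Properties using (remQuot-combine; combine-remQuot)
open import Data.List using ([]; _∷_; map; _++_; filter; length)
open import Data.Product using (_,_; uncurry)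
open import Data.Product.Properties using (×-≡,≡→≡)
open import Data.Sum using (_⊎_; inj₁; inj₂; [_,_])
open import Data.Bool using (true; false; _xor_)
open import Data.Bool.Properties using (T?; xor-assoc; xor-same; xor-identityʳ; xor-∧-commutativeRing)
open import Data.Unit using (⊤; tt)
open import Data.Empty using (⊥-elim)
open import Function using (_∘_)
open import Algebra.Bundles using (CommutativeRing)
open import Algebra.Properties.CommutativeSemigroup
  (CommutativeRing.+-commutativeSemigroup xor-∧-commutativeRing) using (interchange)
open import Relation.Nullary using (¬_)
open import Relation.Binary.PropositionalEquality
  using (refl; sym; trans; cong; cong₂; cong-app; _≗_; module ≡-Reasoning)

record Enumeration (n : ℕ) (T : Set) (P : (T → Bool) → Set) : Set where
  field
    enum      : Fin n → T → Bool
    sound     : ∀ j → P (enum j)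
    complete  : ∀ E → P E → Σ (Fin n) λ j → E ≗ enum j
    injective : ∀ j k → enum j ≗ enum k → j ≡ k
open Enumeration

resize : ∀ {n m T P} → n ≡ m → Enumeration n T P → Enumeration m T P
resize refl C = C

respecify : ∀ {n T} {P Q : (T → Bool) → Set} →
  (∀ E → P E → Q E) → (∀ E → Q E → P E) → Enumeration n T P → Enumeration n T Q
respecify P⇒Q Q⇒P C = record
  { enum      = enum C
  ; sound     = λ j → P⇒Q _ (sound C j)
  ; complete  = λ E q → complete C E (Q⇒P E q)
  ; injective = injective C
  }

empty-domain : ∀ {T P} → ¬ T → (∀ E → P E) → Enumeration 1 T P
empty-domain ¬t always = record
  { enum      = λ _ _ → false
  ; sound     = λ _ → always _
  ; complete  = λ _ _ → zero , λ t → ⊥-elim (¬t t)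
  ; injective = λ { zero zero _ → refl }
  }

unit-domain : Enumeration 2 ⊤ (λ _ → ⊤)
unit-domain = record
  { enum      = constant
  ; sound     = λ _ → tt
  ; complete  = λ E _ → which E (E tt) refl
  ; injective = distinct
  }
  where
  constant : Fin 2 → ⊤ → Bool
  constant zero    _ = false
  constant (suc _) _ = true

  which : ∀ E b → E tt ≡ b → Σ (Fin 2) λ j → E ≗ constant j
  which E false e = zero , λ _ → e
  which E true  e = suc zero , λ _ → e

  distinct : ∀ j k → constant j ≗ constant k → j ≡ k
  distinct zero       zero       _ = refl
  distinct zero       (suc zero) e with () ← e tt
  distinct (suc zero) zero       e with () ← e tt
  distinct (suc zero) (suc zero) _ = refl

record Recoding (T U : Set) : Set where
  field
    to        : (T → Bool) → U → Bool
    from      : (U → Bool) → T → Bool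
    to-cong   : ∀ {E E'} → E ≗ E' → to E ≗ to E'
    from-cong : ∀ {E E'} → E ≗ E' → from E ≗ from E'
    to-from   : ∀ E → to (from E) ≗ E
    from-to   : ∀ E → from (to E) ≗ E
open Recoding

recode : ∀ {n T U P Q} (R : Recoding T U) →
  (∀ E → P E → Q (to R E)) → (∀ E → Q E → P (from R E)) →
  Enumeration n T P → Enumeration n U Q
recode R P⇒Q Q⇒P C = record
  { enum      = λ j → to R (enum C j)
  ; sound     = λ j → P⇒Q _ (sound C j)
  ; complete  = λ E q → let (j , E≗) = complete C (from R E) (Q⇒P E q) in
      j , λ u → trans (sym (to-from R E u)) (to-cong R E≗ u)
  ; injective = λ j k e → injective C j k λ t →
      trans (sym (from-to R _ t)) (trans (from-cong R e t) (from-to R _ t))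
  }

product : ∀ {n m T U P Q} → Enumeration n T P → Enumeration m U Q →
  Enumeration (n * m) (T ⊎ U) (λ E → P (E ∘ inj₁) × Q (E ∘ inj₂))
product {n} {m} {T} {U} {P} {Q} A B = record
  { enum      = pair
  ; sound     = λ _ → sound A _ , sound B _
  ; complete  = completeness
  ; injective = injectivity
  }
  where
  parts : Fin n × Fin m → T ⊎ U → Bool
  parts (i , j) = [ enum A i , enum B j ]

  pair : Fin (n * m) → T ⊎ U → Bool
  pair c = parts (remQuot m c)

  pair-combine : ∀ i j → pair (combine i j) ≗ parts (i , j)
  pair-combine i j = cong-app (cong parts (remQuot-combine i j))

  completeness : ∀ E → P (E ∘ inj₁) × Q (E ∘ inj₂) → Σ (Fin (n * m)) λ c → E ≗ pair c
  completeness E (p , q) with (i , E₁≗) ← complete A (E ∘ inj₁) p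
                            | (j , E₂≗) ← complete B (E ∘ inj₂) q
    = combine i j , λ x → trans (on x) (sym (pair-combine i j x))
    where
    on : E ≗ parts (i , j)
    on (inj₁ t) = E₁≗ t
    on (inj₂ u) = E₂≗ u

  injectivity : ∀ c c' → pair c ≗ pair c' → c ≡ c'
  injectivity c c' e = begin
    c                                  ≡⟨ combine-remQuot {n} m c ⟨
    uncurry combine (remQuot {n} m c)  ≡⟨ cong (uncurry combine) same-parts ⟩
    uncurry combine (remQuot {n} m c') ≡⟨ combine-remQuot {n} m c' ⟩
    c'                                 ∎
    where
    open ≡-Reasoning
    same-parts : remQuot {n} m c ≡ remQuot m c'
    same-parts = ×-≡,≡→≡ (injective A _ _ (e ∘ inj₁) , injective B _ _ (e ∘ inj₂))

slice : ∀ {k} {T : Set} → (Fin k × T → Bool) → Fin k → T → Bool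
slice E a t = E (a , t)

peel : ∀ k {T} → Recoding (T ⊎ (Fin k × T)) (Fin (suc k) × T)
peel k {T} = record
  { to        = glue
  ; from      = split
  ; to-cong   = λ { e (zero , t) → e (inj₁ t) ; e (suc a , t) → e (inj₂ (a , t)) }
  ; from-cong = λ { e (inj₁ t) → e (zero , t) ; e (inj₂ (a , t)) → e (suc a , t) }
  ; to-from   = λ { E (zero , t) → refl ; E (suc a , t) → refl }
  ; from-to   = λ { E (inj₁ t) → refl ; E (inj₂ p) → refl }
  }
  where
  glue : (T ⊎ (Fin k × T) → Bool) → Fin (suc k) × T → Bool
  glue E (zero  , t) = E (inj₁ t)
  glue E (suc a , t) = E (inj₂ (a , t))

  split : (Fin (suc k) × T → Bool) → T ⊎ (Fin k × T) → Bool
  split E (inj₁ t)       = E (zero , t)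
  split E (inj₂ (a , t)) = E (suc a , t)

power : ∀ k {m T P} → Enumeration m T P →
  Enumeration (m ^ k) (Fin k × T) (λ E → ∀ a → P (slice E a))
power zero    C = empty-domain (λ { (() , _) }) (λ _ ())
power (suc k) C = recode (peel k)
  (λ { E (p , q) zero → p ; E (p , q) (suc a) → q a })
  (λ E slices → slices zero , λ a → slices (suc a))
  (product C (power k C))

all-edge-sets : ∀ ms → Enumeration (2 ^ prod ms) (Tuple ms) (λ _ → ⊤)
all-edge-sets []       = unit-domain
all-edge-sets (k ∷ ks) =
  resize (trans (^-*-assoc 2 (prod ks) k) (cong (2 ^_) (*-comm (prod ks) k)))
    (respecify (λ _ _ → tt) (λ _ _ _ → tt) (power k (all-edge-sets ks)))

parity : {T : Set} → (T → Bool) → List T → Bool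
parity f []       = false
parity f (x ∷ xs) = f x xor parity f xs

parity-++ : {T : Set} (f : T → Bool) (xs ys : List T) →
  parity f (xs ++ ys) ≡ parity f xs xor parity f ys
parity-++ f []       ys = refl
parity-++ f (x ∷ xs) ys =
  trans (cong (f x xor_) (parity-++ f xs ys)) (sym (xor-assoc (f x) (parity f xs) (parity f ys)))

parity-map : {T U : Set} (f : U → Bool) (g : T → U) (xs : List T) →
  parity f (map g xs) ≡ parity (f ∘ g) xs
parity-map f g []       = refl
parity-map f g (x ∷ xs) = cong (f (g x) xor_) (parity-map f g xs)

parity-cong : {T : Set} {f g : T → Bool} → f ≗ g → (xs : List T) → parity f xs ≡ parity g xs
parity-cong f≗g []       = refl
parity-cong f≗g (x ∷ xs) = cong₂ _xor_ (f≗g x) (parity-cong f≗g xs)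

parity-xor : {T : Set} (f g : T → Bool) (xs : List T) →
  parity (λ t → f t xor g t) xs ≡ parity f xs xor parity g xs
parity-xor f g []       = refl
parity-xor f g (x ∷ xs) =
  trans (cong ((f x xor g x) xor_) (parity-xor f g xs))
        (interchange (f x) (g x) (parity f xs) (parity g xs))

xor-cancelʳ : ∀ x y → (x xor y) xor y ≡ x
xor-cancelʳ x y =
  trans (xor-assoc x y y) (trans (cong (x xor_) (xor-same y)) (xor-identityʳ x))

xor≡false⇒≡ : ∀ x y → x xor y ≡ false → x ≡ y
xor≡false⇒≡ false false _ = refl
xor≡false⇒≡ true  true  _ = refl

bit : Bool → ℕ
bit false = 0
bit true  = 1

count-mod-2 : {T : Set} (f : T → Bool) (xs : List T) →
  length (filter (λ t → T? (f t)) xs) % 2 ≡ bit (parity f xs)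
count-mod-2 f []       = refl
count-mod-2 f (x ∷ xs) with f x
... | false = count-mod-2 f xs
... | true  = begin
  suc c % 2                      ≡⟨ %-distribˡ-+ 1 c 2 ⟩
  (1 + c % 2) % 2                ≡⟨ cong (λ r → (1 + r) % 2) (count-mod-2 f xs) ⟩
  (1 + bit (parity f xs)) % 2    ≡⟨ flip (parity f xs) ⟩
  bit (true xor parity f xs)     ∎
  where
  open ≡-Reasoning
  c = length (filter (λ t → T? (f t)) xs)
  flip : ∀ b → (1 + bit b) % 2 ≡ bit (true xor b)
  flip false = refl
  flip true  = refl

Balanced : (ms : List ℕ) → EdgeSet ms → Set
Balanced ms E = (X : Box ms) → parity E (boxTuples ms X) ≡ false

octahedral⇒balanced : ∀ ms E → IsOctahedral ms E → Balanced ms E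
octahedral⇒balanced ms E oct X = bit≡0 (trans (sym (count-mod-2 E (boxTuples ms X))) (oct X))
  where
  bit≡0 : ∀ {b} → bit b ≡ 0 → b ≡ false
  bit≡0 {false} _ = refl

balanced⇒octahedral : ∀ ms E → Balanced ms E → IsOctahedral ms E
balanced⇒octahedral ms E bal X = trans (count-mod-2 E (boxTuples ms X)) (cong bit (bal X))

balanced-cong : ∀ ms {E E'} → E ≗ E' → Balanced ms E → Balanced ms E'
balanced-cong ms E≗E' bal X = trans (sym (parity-cong E≗E' (boxTuples ms X))) (bal X)

parity-box : ∀ k ks (E : EdgeSet (k ∷ ks)) a b (a≢b : ¬ a ≡ b) X →
  parity E (boxTuples (k ∷ ks) ((a , b , a≢b) , X))
    ≡ parity (slice E a) (boxTuples ks X) xor parity (slice E b) (boxTuples ks X)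
parity-box k ks E a b _ X = begin
  parity E (map (a ,_) L ++ map (b ,_) L)
    ≡⟨ parity-++ E (map (a ,_) L) (map (b ,_) L) ⟩
  parity E (map (a ,_) L) xor parity E (map (b ,_) L)
    ≡⟨ cong₂ _xor_ (parity-map E (a ,_) L) (parity-map E (b ,_) L) ⟩
  parity (slice E a) L xor parity (slice E b) L
    ∎
  where
  open ≡-Reasoning
  L = boxTuples ks X

difference : ∀ {k} {T : Set} → (Fin (suc k) × T → Bool) → Fin k → T → Bool
difference E a t = E (suc a , t) xor E (zero , t)

balanced⇒differences : ∀ k ks (E : EdgeSet (suc k ∷ ks)) →
  Balanced (suc k ∷ ks) E → ∀ a → Balanced ks (difference E a)
balanced⇒differences k ks E bal a X = begin
  parity (difference E a) L
    ≡⟨ parity-xor (slice E (suc a)) (slice E zero) L ⟩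
  parity (slice E (suc a)) L xor parity (slice E zero) L
    ≡⟨ parity-box (suc k) ks E (suc a) zero (λ ()) X ⟨
  parity E (boxTuples (suc k ∷ ks) box)
    ≡⟨ bal box ⟩
  false
    ∎
  where
  open ≡-Reasoning
  L = boxTuples ks X
  box = (suc a , zero , λ ()) , X

-- Key lemma, ⇐: balanced differences make all slices have equal parity over
-- each X, so the two slices of any box cancel.
differences⇒balanced : ∀ k ks (E : EdgeSet (suc k ∷ ks)) →
  (∀ a → Balanced ks (difference E a)) → Balanced (suc k ∷ ks) E
differences⇒balanced k ks E bal ((a , b , a≢b) , X) = begin
  parity E (boxTuples (suc k ∷ ks) ((a , b , a≢b) , X))
    ≡⟨ parity-box (suc k) ks E a b a≢b X ⟩
  p a xor p b
    ≡⟨ cong (p a xor_) (trans (same-as-zero b) (sym (same-as-zero a))) ⟩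
  p a xor p a
    ≡⟨ xor-same (p a) ⟩
  false
    ∎
  where
  open ≡-Reasoning
  p : Fin (suc k) → Bool
  p c = parity (slice E c) (boxTuples ks X)

  same-as-zero : ∀ c → p c ≡ p zero
  same-as-zero zero    = refl
  same-as-zero (suc c) = xor≡false⇒≡ (p (suc c)) (p zero)
    (trans (sym (parity-xor (slice E (suc c)) (slice E zero) (boxTuples ks X))) (bal c X))

shear : ∀ k {T} → Recoding (T ⊎ (Fin k × T)) (Fin (suc k) × T)
shear k {T} = record
  { to        = integrate
  ; from      = differentiate
  ; to-cong   = λ { e (zero , t) → e (inj₁ t)
                  ; e (suc a , t) → cong₂ _xor_ (e (inj₂ (a , t))) (e (inj₁ t)) }
  ; from-cong = λ { e (inj₁ t) → e (zero , t)
                  ; e (inj₂ (a , t)) → cong₂ _xor_ (e (suc a , t)) (e (zero , t)) }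
  ; to-from   = λ { E (zero , t) → refl ; E (suc a , t) → xor-cancelʳ _ _ }
  ; from-to   = λ { E (inj₁ t) → refl ; E (inj₂ p) → xor-cancelʳ _ _ }
  }
  where
  integrate : (T ⊎ (Fin k × T) → Bool) → Fin (suc k) × T → Bool
  integrate D (zero  , t) = D (inj₁ t)
  integrate D (suc a , t) = D (inj₂ (a , t)) xor D (inj₁ t)

  differentiate : (Fin (suc k) × T → Bool) → T ⊎ (Fin k × T) → Bool
  differentiate E (inj₁ t)       = E (zero , t)
  differentiate E (inj₂ (a , t)) = difference E a t

prodPred≤prod : ∀ ms → prodPred ms ≤ prod ms
prodPred≤prod []       = s≤s z≤n
prodPred≤prod (k ∷ ks) = *-mono-≤ (m∸n≤m k 1) (prodPred≤prod ks)

shear-exponent : ∀ k N P → P ≤ N → 2 ^ N * (2 ^ (N ∸ P)) ^ k ≡ 2 ^ (suc k * N ∸ k * P)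
shear-exponent k N P P≤N = begin
  2 ^ N * (2 ^ (N ∸ P)) ^ k      ≡⟨ cong (2 ^ N *_) (^-*-assoc 2 (N ∸ P) k) ⟩
  2 ^ N * 2 ^ ((N ∸ P) * k)      ≡⟨ ^-distribˡ-+-* 2 N ((N ∸ P) * k) ⟨
  2 ^ (N + (N ∸ P) * k)          ≡⟨ cong (λ e → 2 ^ (N + e)) (trans (*-comm (N ∸ P) k) (*-distribˡ-∸ k N P)) ⟩
  2 ^ (N + (k * N ∸ k * P))      ≡⟨ cong (2 ^_) (+-∸-assoc N (*-monoʳ-≤ k P≤N)) ⟨
  2 ^ (N + k * N ∸ k * P)        ∎
  where open ≡-Reasoning

balanced-edge-sets : ∀ ms → Enumeration (2 ^ (prod ms ∸ prodPred ms)) (Tuple ms) (Balanced ms)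
balanced-edge-sets []           = record
  { enum      = λ _ _ → false
  ; sound     = λ _ _ → refl
  ; complete  = λ E bal → zero , λ _ → trans (sym (xor-identityʳ (E tt))) (bal tt)
  ; injective = λ { zero zero _ → refl }
  }
balanced-edge-sets (zero  ∷ ks) = empty-domain (λ { (() , _) }) (λ { _ ((() , _) , _) })
balanced-edge-sets (suc k ∷ ks) =
  resize (shear-exponent k (prod ks) (prodPred ks) (prodPred≤prod ks))
    (recode (shear k) integrate-balanced differentiate-balanced
      (product (all-edge-sets ks) (power k (balanced-edge-sets ks))))
  where
  integrate-balanced : ∀ D → ⊤ × (∀ a → Balanced ks (slice (D ∘ inj₂) a)) →
    Balanced (suc k ∷ ks) (to (shear k) D)
  integrate-balanced D (_ , bal) = differences⇒balanced k ks _ λ a →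
    balanced-cong ks (λ t → sym (xor-cancelʳ _ _)) (bal a)

  differentiate-balanced : ∀ E → Balanced (suc k ∷ ks) E →
    ⊤ × (∀ a → Balanced ks (slice (from (shear k) E ∘ inj₂) a))
  differentiate-balanced E bal = tt , balanced⇒differences k ks E bal

-- Theorem 3.2.
theorem3p2 : (ms : List ℕ) → All (2 ≤_) ms →
    Σ (Fin (2 ^ (prod ms ∸ prodPred ms)) → EdgeSet ms) λ f →
      ((j : Fin (2 ^ (prod ms ∸ prodPred ms))) → IsOctahedral ms (f j))
      × ((E : EdgeSet ms) → IsOctahedral ms E →
           Σ (Fin (2 ^ (prod ms ∸ prodPred ms))) λ j → (t : Tuple ms) → E t ≡ f j t)
      × ((j k : Fin (2 ^ (prod ms ∸ prodPred ms))) →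
           ((t : Tuple ms) → f j t ≡ f k t) → j ≡ k)
theorem3p2 ms _ =
    enum C
  , (λ j → balanced⇒octahedral ms (enum C j) (sound C j))
  , (λ E oct → complete C E (octahedral⇒balanced ms E oct))
  , injective C
  where
  C = balanced-edge-sets ms
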